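{- Let $\mathcal{G}$ be a temporal graph with lifetime $T$, let $\omega\ge0$, and fix integers $0 = t_0 < t_1 < \cdots < t_{\ell} = T$. Then $$ \sum_{i=1}^{\ell} \widetilde{q}^{\,*}_\omega(\mathcal{G}_{[t_{i-1}+1,t_i]}) \leq \widetilde{q}^{\,*}_\omega(\mathcal{G}).$$
   Context: A temporal graph $\mathcal{G}=(G,\lambda)$ with lifetime $T$ consists of a simple undirected graph $G=(V,E)$ and $\lambda:E\to2^{[T]}$. Snapshots are $G_t=(V,E_t)$, $E_t=\{e: t\in\lambda(e)\}$, $m_t=|E_t|$, degrees $d_{v,t}$; $e_{G_t}(A)$ is the number of edges of $G_t$ inside $A\subseteq V$ and $\mathrm{vol}_{G_t}(A)=\sum_{v\in A}d_{v,t}$. A partition $\mathcal{A}$ of a temporal graph on timesteps $a,\dots,b$ is a function $\pi_{\mathcal{A}}:V\times\{a,\dots,b\}\to[k]$ (some $k$), inducing partitions $\mathcal{A}_t$ of $V$; its loyalty contribution is $\mathcal{L}(\mathcal{A})=\sum_{v\in V}\sum_{t=a}^{b-1}\mathbf{1}[\pi_{\mathcal{A}}(v,t)=\pi_{\mathcal{A}}(v,t+1)]$. The non-normalised temporal modularity is $\widetilde{q}_\omega(\mathcal{G},\mathcal{A})=\sum_{t}\sum_{A\in\mathcal{A}_t}\left(2e_{G_t}(A)-\frac{\mathrm{vol}_{G_t}(A)^2}{2m_t}\right)+\omega\mathcal{L}(\mathcal{A})$ (sum over the timesteps of the graph), and $\widetilde{q}^{\,*}_\omega$ is its maximum over all partitions.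 For $1\le a\le b\le T$, $\mathcal{G}_{[a,b]}=(G,\lambda')$ with $\lambda'(e)=\lambda(e)\cap\{a,\dots,b\}$ is the restriction of $\mathcal{G}$ to timesteps $a,\dots,b$, whose snapshots are $G_a,\dots,G_b$.
   Formalization: The parameter ω ranges over the nonnegative rationals. -}

module Defs where

open import Data.Nat as ℕ using (ℕ; zero; suc; _<_)
open import Data.Bool using (Bool; true; false; if_then_else_)
open import Data.Fin using (Fin; toℕ)
open import Data.List using (List; []; _∷_; map; filter; foldr; allFin; upTo; deduplicate; length)
open import Data.Integer using (+_)
open import Data.Rational using (ℚ; _/_; 0ℚ; _+_; _-_; _*_; _≤_)
open import Data.Product using (Σ; _×_)
open import Relation.Binary.PropositionalEquality using (_≡_)
open import Relation.Nullary.Decidable using (does)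
open import Data.Fin.Properties using () renaming (_<?_ to _<ᶠ?_)

-- Timesteps are natural numbers;
-- snapshot G_t has edge {u,v} iff adj t u v ≡ true.  Equivalently λ(e) = { t | adj t u v }.
-- Only timesteps in [1,T] are ever inspected (via the lifetime argument).
record TemporalGraph (n : ℕ) : Set where
  field
    adj    : ℕ → Fin n → Fin n → Bool
    sym    : ∀ t u v → adj t u v ≡ adj t v u
    irrefl : ∀ t v → adj t v v ≡ false
open TemporalGraph public

-- A partition on timesteps a..b: community label π v t (labels in ℕ; values outside a..b are irrelevant).
Partition : ℕ → Set
Partition n = Fin n → ℕ → ℕ

-- timesteps a, a+1, ..., b   (empty if b < a)
range : ℕ → ℕ → List ℕ
range a b = map (a ℕ.+_) (upTo (suc b ℕ.∸ a))

sumℕ : List ℕ → ℕ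
sumℕ = foldr ℕ._+_ 0

sumℚ : List ℚ → ℚ
sumℚ = foldr _+_ 0ℚ

ind : Bool → ℕ
ind true  = 1
ind false = 0

ℕ→ℚ : ℕ → ℚ
ℕ→ℚ k = + k / 1

module _ {n : ℕ} (G : TemporalGraph n) where

  vertices : List (Fin n)
  vertices = allFin n

  pairs : List (Fin n × Fin n)
  pairs = Data.List.concatMap (λ u → map (λ v → u Data.Product., v) (filter (λ v → u <ᶠ? v) vertices)) vertices

  numEdges : ℕ → ℕ
  numEdges t = sumℕ (map (λ p → ind (adj G t (Data.Product.proj₁ p) (Data.Product.proj₂ p))) pairs)

  degree : ℕ → Fin n → ℕ
  degree t v = sumℕ (map (λ u → ind (adj G t v u)) vertices)

  edgesIn : ℕ → (Fin n → Bool) → ℕ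
  edgesIn t A = sumℕ (map (λ p → ind (A (Data.Product.proj₁ p) Data.Bool.∧ A (Data.Product.proj₂ p)
                                        Data.Bool.∧ adj G t (Data.Product.proj₁ p) (Data.Product.proj₂ p))) pairs)

  vol : ℕ → (Fin n → Bool) → ℕ
  vol t A = sumℕ (map (λ v → if A v then degree t v else 0) vertices)

  -- vol² / (2 m_t); when m_t = 0 every volume is 0, and the term is taken to be 0.
  penalty : ℕ → ℕ → ℚ
  penalty t V with numEdges t
  ... | zero  = 0ℚ
  ... | suc m = + (V ℕ.* V) / (2 ℕ.* suc m)

  -- the communities of A_t: one per label actually used at time t
  communityLabels : Partition n → ℕ → List ℕ
  communityLabels π t = deduplicate ℕ._≟_ (map (λ v → π v t) vertices)

  community : Partition n → ℕ → ℕ → Fin n → Bool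
  community π t c v = does (π v t ℕ.≟ c)

  snapshotModularity : Partition n → ℕ → ℚ
  snapshotModularity π t =
    sumℚ (map (λ c → ℕ→ℚ (2 ℕ.* edgesIn t (community π t c)) - penalty t (vol t (community π t c)))
              (communityLabels π t))

  loyalty : ℕ → ℕ → Partition n → ℕ
  loyalty a b π = sumℕ (map (λ v → sumℕ (map (λ t → ind (does (π v t ℕ.≟ π v (suc t))))
                                             (map (a ℕ.+_) (upTo (b ℕ.∸ a))))) vertices)

  -- non-normalised temporal modularity of the restriction G_[a,b] with partition π
  tmod : ℚ → ℕ → ℕ → Partition n → ℚ
  tmod ω a b π = sumℚ (map (snapshotModularity π) (range a b)) + ω * ℕ→ℚ (loyalty a b π)

  IsMaxTMod : ℚ → ℕ → ℕ → ℚ → Set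
  IsMaxTMod ω a b q = Σ (Partition n) (λ π → tmod ω a b π ≡ q) × (∀ π → tmod ω a b π ≤ q)

{-# OPTIONS --safe #-}
-- Glue optimal partitions of the consecutive intervals into one partition of [1, T] that
-- follows the i-th partition on the i-th interval. Snapshot modularity is computed timestep
-- by timestep, so it adds up exactly; loyalty only gains the steps across the cut points,
-- so with ω ≥ 0 the glued partition scores at least the sum of the optima, and it is in turn
-- dominated by the optimum over [1, T].
module Submission where

open import Defs hiding (sym)
open import Data.Nat using (ℕ; suc; _<_; _+_)
open import Data.Fin using (Fin; zero; suc; fromℕ; inject₁)
open import Data.List using (map; allFin)
open import Data.Rational using (ℚ; 0ℚ; _≤_)
open import Relation.Binary.PropositionalEquality using (_≡_)

open import Function using (_∘_; id)
open import Data.Bool using (Bool; if_then_else_; _∧_)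
open import Data.Product using (∃; _×_; _,_; proj₁; proj₂)
open import Data.List using (List; []; _∷_; _++_; _∷ʳ_; upTo; deduplicate)
open import Data.List.Properties using (map-cong; map-cong-local; map-++; ++-assoc; ++-identityʳ; map-tabulate; upTo-∷ʳ)
open import Data.List.Membership.Propositional using (_∈_)
open import Data.List.Membership.Propositional.Properties using (∈-map⁻; ∈-upTo⁻)
import Data.List.Relation.Unary.All as All
open import Data.Nat as ℕ using (_∸_; _≟_; _≤?_; _≤′_; ≤′-refl; ≤′-step)
import Data.Nat.Properties as ℕP
open import Data.Nat.ListAction.Properties using (sum-++)
import Data.Integer as ℤ
import Data.Integer.Properties as ℤP
import Data.Rational as ℚ
import Data.Rational.Properties as ℚP
open import Data.Nat.Coprimality as Coprime using (1-coprimeTo)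
open import Algebra.Bundles using (CommutativeMonoid)
open import Algebra.Properties.CommutativeSemigroup ℕP.+-commutativeSemigroup
  using () renaming (interchange to +-interchange)
open import Algebra.Properties.CommutativeSemigroup
  (CommutativeMonoid.commutativeSemigroup ℚP.+-0-commutativeMonoid)
  using () renaming (interchange to +-interchangeℚ)
open import Relation.Binary.PropositionalEquality using (refl; sym; trans; cong; cong₂; subst₂; module ≡-Reasoning)
open import Relation.Nullary.Decidable using (yes; no; does; dec-true; dec-false)

ℕ→ℚ-mkℚ : ∀ k → ℕ→ℚ k ≡ ℚ.mkℚ (ℤ.+ k) 0 (Coprime.sym (1-coprimeTo k))
ℕ→ℚ-mkℚ k = ℚP.normalize-coprime (Coprime.sym (1-coprimeTo k))

ℕ→ℚ-+ : ∀ x y → ℕ→ℚ (x + y) ≡ ℕ→ℚ x ℚ.+ ℕ→ℚ y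
ℕ→ℚ-+ x y = begin
  ℕ→ℚ (x + y)                          ≡⟨ cong (ℚ._/ 1) (cong₂ ℤ._+_ (ℤP.*-identityʳ (ℤ.+ x)) (ℤP.*-identityʳ (ℤ.+ y))) ⟨
  (ℤ.+ x ℤ.* ℤ.+ 1 ℤ.+ ℤ.+ y ℤ.* ℤ.+ 1) ℚ./ 1  ≡⟨ cong₂ ℚ._+_ (ℕ→ℚ-mkℚ x) (ℕ→ℚ-mkℚ y) ⟨
  ℕ→ℚ x ℚ.+ ℕ→ℚ y                      ∎
  where open ≡-Reasoning

ℕ→ℚ-mono-≤ : ∀ {x y} → x ℕ.≤ y → ℕ→ℚ x ≤ ℕ→ℚ y
ℕ→ℚ-mono-≤ {x} {y} x≤y = subst₂ _≤_ (sym (ℕ→ℚ-mkℚ x)) (sym (ℕ→ℚ-mkℚ y))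
  (ℚ.*≤* (ℤP.*-monoʳ-≤-nonNeg (ℤ.+ 1) (ℤ.+≤+ x≤y)))

sumℚ-++ : ∀ xs ys → sumℚ (xs ++ ys) ≡ sumℚ xs ℚ.+ sumℚ ys
sumℚ-++ []       ys = sym (ℚP.+-identityˡ (sumℚ ys))
sumℚ-++ (x ∷ xs) ys = trans (cong (x ℚ.+_) (sumℚ-++ xs ys)) (sym (ℚP.+-assoc x (sumℚ xs) (sumℚ ys)))

sumℕ-map-+-≤ : ∀ {A : Set} {f g h : A → ℕ} xs → (∀ x → f x + g x ℕ.≤ h x) →
               sumℕ (map f xs) + sumℕ (map g xs) ℕ.≤ sumℕ (map h xs)
sumℕ-map-+-≤ []       _   = ℕ.z≤n
sumℕ-map-+-≤ {f = f} {g} (x ∷ xs) f+g≤h = ℕP.≤-trans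
  (ℕP.≤-reflexive (+-interchange (f x) (sumℕ (map f xs)) (g x) (sumℕ (map g xs))))
  (ℕP.+-mono-≤ (f+g≤h x) (sumℕ-map-+-≤ xs f+g≤h))

sumℕ-map-0 : ∀ {A : Set} (xs : List A) → sumℕ (map (λ _ → 0) xs) ≡ 0
sumℕ-map-0 []       = refl
sumℕ-map-0 (_ ∷ xs) = sumℕ-map-0 xs

-- range a b is halfOpen a (suc b), and loyalty a b sums over halfOpen a b, definitionally.
halfOpen : ℕ → ℕ → List ℕ
halfOpen a b = map (a +_) (upTo (b ∸ a))

halfOpen-empty : ∀ {a b} → b ℕ.≤ a → halfOpen a b ≡ []
halfOpen-empty b≤a rewrite ℕP.m≤n⇒m∸n≡0 b≤a = refl

halfOpen-∷ʳ : ∀ {a b} → a ℕ.≤ b → halfOpen a (suc b) ≡ halfOpen a b ∷ʳ b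
halfOpen-∷ʳ {a} {b} a≤b = begin
  map (a +_) (upTo (suc b ∸ a))             ≡⟨ cong (map (a +_) ∘ upTo) (ℕP.+-∸-assoc 1 a≤b) ⟩
  map (a +_) (upTo (suc (b ∸ a)))           ≡⟨ cong (map (a +_)) (upTo-∷ʳ (b ∸ a)) ⟨
  map (a +_) (upTo (b ∸ a) ∷ʳ (b ∸ a))      ≡⟨ map-++ (a +_) (upTo (b ∸ a)) _ ⟩
  halfOpen a b ∷ʳ (a + (b ∸ a))             ≡⟨ cong (halfOpen a b ∷ʳ_) (ℕP.m+[n∸m]≡n a≤b) ⟩
  halfOpen a b ∷ʳ b                         ∎
  where open ≡-Reasoning

halfOpen-++ : ∀ {a m b} → a ℕ.≤ m → m ℕ.≤ b → halfOpen a b ≡ halfOpen a m ++ halfOpen m b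
halfOpen-++ a≤m = go a≤m ∘ ℕP.≤⇒≤′
  where
  go : ∀ {a m b} → a ℕ.≤ m → m ≤′ b → halfOpen a b ≡ halfOpen a m ++ halfOpen m b
  go {a} {m} a≤m ≤′-refl = begin
    halfOpen a m                 ≡⟨ ++-identityʳ (halfOpen a m) ⟨
    halfOpen a m ++ []           ≡⟨ cong (halfOpen a m ++_) (halfOpen-empty (ℕP.≤-refl {m})) ⟨
    halfOpen a m ++ halfOpen m m ∎
    where open ≡-Reasoning
  go {a} {m} {suc b} a≤m (≤′-step m≤′b) = begin
    halfOpen a (suc b)                  ≡⟨ halfOpen-∷ʳ (ℕP.≤-trans a≤m m≤b) ⟩
    halfOpen a b ∷ʳ b                   ≡⟨ cong (_∷ʳ b) (go a≤m m≤′b) ⟩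
    (halfOpen a m ++ halfOpen m b) ∷ʳ b ≡⟨ ++-assoc (halfOpen a m) (halfOpen m b) _ ⟩
    halfOpen a m ++ halfOpen m b ∷ʳ b   ≡⟨ cong (halfOpen a m ++_) (halfOpen-∷ʳ m≤b) ⟨
    halfOpen a m ++ halfOpen m (suc b)  ∎
    where
    open ≡-Reasoning
    m≤b : m ℕ.≤ b
    m≤b = ℕP.≤′⇒≤ m≤′b

∈-halfOpen⁻ : ∀ {a b t} → t ∈ halfOpen a b → a ℕ.≤ t × t < b
∈-halfOpen⁻ {a} {b} t∈ with i , i∈ , refl ← ∈-map⁻ (a +_) t∈ = ℕP.m≤m+n a i , (begin-strict
  a + i       <⟨ ℕP.+-monoʳ-< a i<b∸a ⟩
  a + (b ∸ a) ≡⟨ ℕP.m+[n∸m]≡n {a} (ℕP.<⇒≤ (ℕP.m∸n≢0⇒n<m (ℕP.m<n⇒n≢0 i<b∸a))) ⟩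
  b           ∎)
  where
  open ℕP.≤-Reasoning
  i<b∸a : i < b ∸ a
  i<b∸a = ∈-upTo⁻ i∈

map-cong-halfOpen : ∀ {A : Set} {f g : ℕ → A} {a b} → (∀ {t} → a ℕ.≤ t → t < b → f t ≡ g t) →
                    map f (halfOpen a b) ≡ map g (halfOpen a b)
map-cong-halfOpen f≡g = map-cong-local (All.tabulate (λ t∈ → let a≤t , t<b = ∈-halfOpen⁻ t∈ in f≡g a≤t t<b))

map-halfOpen-++ : ∀ {A : Set} (f : ℕ → A) {a m b} → a ℕ.≤ m → m ℕ.≤ b →
                  map f (halfOpen a b) ≡ map f (halfOpen a m) ++ map f (halfOpen m b)
map-halfOpen-++ f {a} {m} {b} a≤m m≤b =
  trans (cong (map f) (halfOpen-++ a≤m m≤b)) (map-++ f (halfOpen a m) (halfOpen m b))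

sumℕ-halfOpen-++ : ∀ (f : ℕ → ℕ) {a m b} → a ℕ.≤ m → m ℕ.≤ b →
                   sumℕ (map f (halfOpen a b)) ≡ sumℕ (map f (halfOpen a m)) + sumℕ (map f (halfOpen m b))
sumℕ-halfOpen-++ f {a} {m} {b} a≤m m≤b =
  trans (cong sumℕ (map-halfOpen-++ f a≤m m≤b)) (sum-++ (map f (halfOpen a m)) (map f (halfOpen m b)))

sumℕ-halfOpen-suc-≤ : ∀ (f : ℕ → ℕ) m b → sumℕ (map f (halfOpen (suc m) b)) ℕ.≤ sumℕ (map f (halfOpen m b))
sumℕ-halfOpen-suc-≤ f m b with m ℕ.<? b
... | yes m<b = ℕP.≤-trans (ℕP.m≤n+m _ _) (ℕP.≤-reflexive (sym (sumℕ-halfOpen-++ f (ℕP.n≤1+n m) m<b)))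
... | no m≮b rewrite halfOpen-empty (ℕP.m≤n⇒m≤1+n (ℕP.≮⇒≥ m≮b)) = ℕ.z≤n

sumℚ-halfOpen-++ : ∀ (f : ℕ → ℚ) {a m b} → a ℕ.≤ m → m ℕ.≤ b →
                   sumℚ (map f (halfOpen a b)) ≡ sumℚ (map f (halfOpen a m)) ℚ.+ sumℚ (map f (halfOpen m b))
sumℚ-halfOpen-++ f {a} {m} {b} a≤m m≤b =
  trans (cong sumℚ (map-halfOpen-++ f a≤m m≤b)) (sumℚ-++ (map f (halfOpen a m)) (map f (halfOpen m b)))

module _ {n : ℕ} where

  glue : ℕ → Partition n → Partition n → Partition n
  glue m π₁ π₂ v t = if does (t ≤? m) then π₁ v t else π₂ v t

  module _ (m : ℕ) (π₁ π₂ : Partition n) (v : Fin n) where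

    glue-≤ : ∀ {t} → t ℕ.≤ m → glue m π₁ π₂ v t ≡ π₁ v t
    glue-≤ {t} t≤m rewrite dec-true (t ≤? m) t≤m = refl

    glue-> : ∀ {t} → m < t → glue m π₁ π₂ v t ≡ π₂ v t
    glue-> {t} m<t rewrite dec-false (t ≤? m) (ℕP.<⇒≱ m<t) = refl

  stayed : Partition n → Fin n → ℕ → ℕ
  stayed π v t = ind (does (π v t ≟ π v (suc t)))

module _ {n : ℕ} (G : TemporalGraph n) where

  loyalty-glue : ∀ {a m b} {π₁ π₂ : Partition n} → a ℕ.≤ m → m ℕ.≤ b →
                 loyalty G a m π₁ + loyalty G (suc m) b π₂ ℕ.≤ loyalty G a b (glue m π₁ π₂)
  loyalty-glue {a} {m} {b} {π₁} {π₂} a≤m m≤b = sumℕ-map-+-≤ (vertices G) atVertex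
    where
    sumStayed : Partition n → Fin n → ℕ → ℕ → ℕ
    sumStayed π v a b = sumℕ (map (stayed π v) (halfOpen a b))
    π : Partition n
    π = glue m π₁ π₂
    atVertex : ∀ v → sumStayed π₁ v a m + sumStayed π₂ v (suc m) b ℕ.≤ sumStayed π v a b
    atVertex v = begin
      sumStayed π₁ v a m + sumStayed π₂ v (suc m) b
        ≡⟨ cong₂ (λ xs ys → sumℕ xs + sumℕ ys) before after ⟨
      sumStayed π v a m + sumStayed π v (suc m) b
        ≤⟨ ℕP.+-monoʳ-≤ (sumStayed π v a m) (sumℕ-halfOpen-suc-≤ (stayed π v) m b) ⟩
      sumStayed π v a m + sumStayed π v m b
        ≡⟨ sumℕ-halfOpen-++ (stayed π v) a≤m m≤b ⟨
      sumStayed π v a b ∎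
      where
      open ℕP.≤-Reasoning
      π≡π₁ : ∀ {t} → t ℕ.≤ m → π v t ≡ π₁ v t
      π≡π₁ = glue-≤ m π₁ π₂ v
      π≡π₂ : ∀ {t} → m < t → π v t ≡ π₂ v t
      π≡π₂ = glue-> m π₁ π₂ v
      before : map (stayed π v) (halfOpen a m) ≡ map (stayed π₁ v) (halfOpen a m)
      before = map-cong-halfOpen {a = a} λ _ t<m →
        cong₂ (λ x y → ind (does (x ≟ y))) (π≡π₁ (ℕP.<⇒≤ t<m)) (π≡π₁ t<m)
      after : map (stayed π v) (halfOpen (suc m) b) ≡ map (stayed π₂ v) (halfOpen (suc m) b)
      after = map-cong-halfOpen {b = b} λ m<t _ →
        cong₂ (λ x y → ind (does (x ≟ y))) (π≡π₂ m<t) (π≡π₂ (ℕP.m<n⇒m<1+n m<t))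

  edgesIn-cong : ∀ t {A A′ : Fin n → Bool} → (∀ v → A v ≡ A′ v) → edgesIn G t A ≡ edgesIn G t A′
  edgesIn-cong t A≡A′ = cong sumℕ (map-cong (λ (u , v) →
    cong₂ (λ x y → ind (x ∧ y ∧ adj G t u v)) (A≡A′ u) (A≡A′ v)) (pairs G))

  vol-cong : ∀ t {A A′ : Fin n → Bool} → (∀ v → A v ≡ A′ v) → vol G t A ≡ vol G t A′
  vol-cong t A≡A′ = cong sumℕ (map-cong (λ v → cong (λ x → if x then degree G t v else 0) (A≡A′ v)) (vertices G))

  snapshotModularity-cong : ∀ {π π′ : Partition n} t → (∀ v → π v t ≡ π′ v t) →
                            snapshotModularity G π t ≡ snapshotModularity G π′ t
  snapshotModularity-cong {π} {π′} t π≡π′ = cong sumℚ (trans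
      (cong (map (score π)) (cong (deduplicate _≟_) (map-cong π≡π′ (vertices G))))
      (map-cong (λ c → cong₂ (λ e V → ℕ→ℚ (2 ℕ.* e) ℚ.- penalty G t V)
                             (edgesIn-cong t (sameCommunity c)) (vol-cong t (sameCommunity c)))
                (communityLabels G π′ t)))
    where
    score : Partition n → ℕ → ℚ
    score π c = ℕ→ℚ (2 ℕ.* edgesIn G t (community G π t c)) ℚ.- penalty G t (vol G t (community G π t c))
    sameCommunity : ∀ c v → community G π t c v ≡ community G π′ t c v
    sameCommunity c v = cong (λ x → does (x ≟ c)) (π≡π′ v)

  modularity-glue : ∀ {a m b} {π₁ π₂ : Partition n} → a ℕ.≤ suc m → m ℕ.≤ b →
                    sumℚ (map (snapshotModularity G (glue m π₁ π₂)) (range a b))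
                      ≡ sumℚ (map (snapshotModularity G π₁) (range a m))
                          ℚ.+ sumℚ (map (snapshotModularity G π₂) (range (suc m) b))
  modularity-glue {a} {m} {b} {π₁} {π₂} a≤1+m m≤b = begin
    sumℚ (map (Q π) (range a b))
      ≡⟨ sumℚ-halfOpen-++ (Q π) a≤1+m (ℕ.s≤s m≤b) ⟩
    sumℚ (map (Q π) (range a m)) ℚ.+ sumℚ (map (Q π) (range (suc m) b))
      ≡⟨ cong₂ (λ xs ys → sumℚ xs ℚ.+ sumℚ ys) before after ⟩
    sumℚ (map (Q π₁) (range a m)) ℚ.+ sumℚ (map (Q π₂) (range (suc m) b)) ∎
    where
    open ≡-Reasoning
    Q : Partition n → ℕ → ℚ
    Q = snapshotModularity G
    π : Partition n
    π = glue m π₁ π₂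
    before : map (Q π) (range a m) ≡ map (Q π₁) (range a m)
    before = map-cong-halfOpen {a = a} λ _ t<1+m →
      snapshotModularity-cong {π} {π₁} _ (λ v → glue-≤ m π₁ π₂ v (ℕ.s≤s⁻¹ t<1+m))
    after : map (Q π) (range (suc m) b) ≡ map (Q π₂) (range (suc m) b)
    after = map-cong-halfOpen {b = suc b} λ m<t _ →
      snapshotModularity-cong {π} {π₂} _ (λ v → glue-> m π₁ π₂ v m<t)

  tmod-glue : ∀ {ω} → 0ℚ ≤ ω → ∀ {a m b} {π₁ π₂ : Partition n} → a < m → m ℕ.≤ b →
              tmod G ω (suc a) m π₁ ℚ.+ tmod G ω (suc m) b π₂ ≤ tmod G ω (suc a) b (glue m π₁ π₂)
  tmod-glue {ω} ω≥0 {a} {m} {b} {π₁} {π₂} a<m m≤b = begin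
    (M₁ ℚ.+ ω ℚ.* ℕ→ℚ L₁) ℚ.+ (M₂ ℚ.+ ω ℚ.* ℕ→ℚ L₂)
      ≡⟨ +-interchangeℚ M₁ (ω ℚ.* ℕ→ℚ L₁) M₂ (ω ℚ.* ℕ→ℚ L₂) ⟩
    (M₁ ℚ.+ M₂) ℚ.+ (ω ℚ.* ℕ→ℚ L₁ ℚ.+ ω ℚ.* ℕ→ℚ L₂)
      ≡⟨ cong ((M₁ ℚ.+ M₂) ℚ.+_) (trans (cong (ω ℚ.*_) (ℕ→ℚ-+ L₁ L₂)) (ℚP.*-distribˡ-+ ω (ℕ→ℚ L₁) (ℕ→ℚ L₂))) ⟨
    (M₁ ℚ.+ M₂) ℚ.+ ω ℚ.* ℕ→ℚ (L₁ + L₂)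
      ≤⟨ ℚP.+-monoʳ-≤ (M₁ ℚ.+ M₂) (ℚP.*-monoˡ-≤-nonNeg ω {{ℚ.nonNegative ω≥0}}
           (ℕ→ℚ-mono-≤ (loyalty-glue a<m m≤b))) ⟩
    (M₁ ℚ.+ M₂) ℚ.+ ω ℚ.* ℕ→ℚ L
      ≡⟨ cong (ℚ._+ ω ℚ.* ℕ→ℚ L) (modularity-glue (ℕP.m≤n⇒m≤1+n a<m) m≤b) ⟨
    M ℚ.+ ω ℚ.* ℕ→ℚ L ∎
    where
    open ℚP.≤-Reasoning
    π : Partition n
    π = glue m π₁ π₂
    M₁ M₂ M : ℚ
    M₁ = sumℚ (map (snapshotModularity G π₁) (range (suc a) m))
    M₂ = sumℚ (map (snapshotModularity G π₂) (range (suc m) b))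
    M  = sumℚ (map (snapshotModularity G π) (range (suc a) b))
    L₁ L₂ L : ℕ
    L₁ = loyalty G (suc a) m π₁
    L₂ = loyalty G (suc m) b π₂
    L  = loyalty G (suc a) b π

  tmod-empty : ∀ {ω a b} (π : Partition n) → b < a → tmod G ω a b π ≡ 0ℚ
  tmod-empty {ω} {a} {b} π b<a = begin
    sumℚ (map (snapshotModularity G π) (range a b)) ℚ.+ ω ℚ.* ℕ→ℚ (loyalty G a b π)
      ≡⟨ cong₂ (λ ts k → sumℚ (map (snapshotModularity G π) ts) ℚ.+ ω ℚ.* ℕ→ℚ k)
               (halfOpen-empty b<a) noLoyalty ⟩
    0ℚ ℚ.+ ω ℚ.* 0ℚ
      ≡⟨ trans (ℚP.+-identityˡ (ω ℚ.* 0ℚ)) (ℚP.*-zeroʳ ω) ⟩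
    0ℚ ∎
    where
    open ≡-Reasoning
    noLoyalty : loyalty G a b π ≡ 0
    noLoyalty = trans (cong (λ ts → sumℕ (map (λ v → sumℕ (map (stayed π v) ts)) (vertices G)))
                            (halfOpen-empty (ℕP.<⇒≤ b<a)))
                      (sumℕ-map-0 (vertices G))

Increasing : ∀ {ℓ} → (Fin (suc ℓ) → ℕ) → Set
Increasing {ℓ} ts = (i : Fin ℓ) → ts (inject₁ i) < ts (suc i)

Increasing⇒first≤last : ∀ {ℓ} (ts : Fin (suc ℓ) → ℕ) → Increasing ts → ts zero ℕ.≤ ts (fromℕ ℓ)
Increasing⇒first≤last {ℕ.zero}  ts _   = ℕP.≤-refl
Increasing⇒first≤last {suc ℓ} ts inc = ℕP.≤-trans (ℕP.<⇒≤ (inc zero)) (Increasing⇒first≤last (ts ∘ suc) (inc ∘ suc))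

map-allFin-suc : ∀ {A : Set} {ℓ} (f : Fin (suc ℓ) → A) → map f (allFin (suc ℓ)) ≡ f zero ∷ map (f ∘ suc) (allFin ℓ)
map-allFin-suc f = cong (f zero ∷_) (trans (map-tabulate suc f) (sym (map-tabulate id (f ∘ suc))))

module _ {n : ℕ} (G : TemporalGraph n) {ω : ℚ} (ω≥0 : 0ℚ ≤ ω) where

  tmod-glue-intervals : ∀ {ℓ} (ts : Fin (suc ℓ) → ℕ) → Increasing ts → (πs : Fin ℓ → Partition n) →
    ∃ λ π → sumℚ (map (λ i → tmod G ω (suc (ts (inject₁ i))) (ts (suc i)) (πs i)) (allFin ℓ))
              ≤ tmod G ω (suc (ts zero)) (ts (fromℕ ℓ)) π
  tmod-glue-intervals {ℕ.zero} ts _ _ =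
    (λ _ _ → 0) , ℚP.≤-reflexive (sym (tmod-empty G {ω} (λ _ _ → 0) (ℕP.n<1+n (ts zero))))
  tmod-glue-intervals {suc ℓ} ts inc πs = glue (ts (suc zero)) (πs zero) π , (begin
    sumℚ (map Q (allFin (suc ℓ)))
      ≡⟨ cong sumℚ (map-allFin-suc Q) ⟩
    Q zero ℚ.+ sumℚ (map (Q ∘ suc) (allFin ℓ))
      ≤⟨ ℚP.+-monoʳ-≤ (Q zero) rest≤π ⟩
    Q zero ℚ.+ tmod G ω (suc (ts (suc zero))) (ts (fromℕ (suc ℓ))) π
      ≤⟨ tmod-glue G ω≥0 (inc zero) (Increasing⇒first≤last (ts ∘ suc) (inc ∘ suc)) ⟩
    tmod G ω (suc (ts zero)) (ts (fromℕ (suc ℓ))) (glue (ts (suc zero)) (πs zero) π) ∎)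
    where
    open ℚP.≤-Reasoning
    Q : Fin (suc ℓ) → ℚ
    Q i = tmod G ω (suc (ts (inject₁ i))) (ts (suc i)) (πs i)
    rest = tmod-glue-intervals (ts ∘ suc) (inc ∘ suc) (πs ∘ suc)
    π : Partition n
    π = proj₁ rest
    rest≤π : sumℚ (map (Q ∘ suc) (allFin ℓ)) ≤ tmod G ω (suc (ts (suc zero))) (ts (fromℕ (suc ℓ))) π
    rest≤π = proj₂ rest

lemma4 : ∀ {n : ℕ} (G : TemporalGraph n) (T : ℕ) (ω : ℚ) → 0ℚ ≤ ω →
         (ℓ : ℕ) (ts : Fin (suc ℓ) → ℕ) →
         ts zero ≡ 0 → ts (fromℕ ℓ) ≡ T → (∀ (i : Fin ℓ) → ts (inject₁ i) < ts (suc i)) →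
         (qs : Fin ℓ → ℚ) → (∀ (i : Fin ℓ) → IsMaxTMod G ω (ts (inject₁ i) + 1) (ts (suc i)) (qs i)) →
         (q : ℚ) → IsMaxTMod G ω 1 T q →
         sumℚ (map qs (allFin ℓ)) ≤ q
lemma4 G T ω ω≥0 ℓ ts t₀≡0 tℓ≡T inc qs qs-max q q-max = begin
  sumℚ (map qs (allFin ℓ))
    ≡⟨ cong sumℚ (map-cong attained (allFin ℓ)) ⟨
  sumℚ (map (λ i → tmod G ω (suc (ts (inject₁ i))) (ts (suc i)) (πs i)) (allFin ℓ))
    ≤⟨ proj₂ glued ⟩
  tmod G ω (suc (ts zero)) (ts (fromℕ ℓ)) π
    ≡⟨ cong₂ (λ a b → tmod G ω (suc a) b π) t₀≡0 tℓ≡T ⟩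
  tmod G ω 1 T π
    ≤⟨ proj₂ q-max π ⟩
  q ∎
  where
  open ℚP.≤-Reasoning
  πs : Fin ℓ → Partition _
  πs i = proj₁ (proj₁ (qs-max i))
  attained : ∀ i → tmod G ω (suc (ts (inject₁ i))) (ts (suc i)) (πs i) ≡ qs i
  attained i = trans (cong (λ a → tmod G ω a (ts (suc i)) (πs i)) (ℕP.+-comm 1 (ts (inject₁ i))))
                     (proj₂ (proj₁ (qs-max i)))
  glued = tmod-glue-intervals G ω≥0 ts inc πs
  π : Partition _
  π = proj₁ glued
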